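{- If $T$ is a finite unicentric tree (of order at least $3$), then $D'(T) = D(T)$.
   Context: A tree is unicentric if its center (the subgraph induced by the vertices of minimum eccentricity) consists of a single vertex. $D(G)$ (the distinguishing number) is the least number $r$ of labels in a vertex labeling $V(G)\to\{1,\dots,r\}$ preserved by no non-identity automorphism of $G$; $D'(G)$ (the distinguishing index) is the least number of labels in an edge labeling preserved by no non-identity automorphism of $G$. -}

module Defs where

open import Data.Nat using (ℕ; zero; suc; _≤_; _<_)
open import Data.Fin using (Fin)
open import Data.Bool using (Bool; true; false)
open import Data.List using (List; []; _∷_; _++_; [_]; length)
open import Data.List.Relation.Unary.Linked using (Linked)
open import Data.List.Relation.Unary.Unique.Propositional using (Unique)
open import Data.Product using (Σ; ∃; ∃-syntax; _×_; _,_)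
open import Relation.Binary.PropositionalEquality using (_≡_)
open import Relation.Nullary using (¬_)

record Graph (n : ℕ) : Set where
  field
    adj     : Fin n → Fin n → Bool
    adj-sym : ∀ u v → adj u v ≡ adj v u
    irrefl  : ∀ v → adj v v ≡ false
open Graph public

module _ {n : ℕ} (G : Graph n) where

  Adj : Fin n → Fin n → Set
  Adj u v = adj G u v ≡ true

  data Walk : Fin n → Fin n → ℕ → Set where
    nil  : ∀ {u} → Walk u u 0
    cons : ∀ {u v w k} → Adj u v → Walk v w k → Walk u w (suc k)

  Connected : Set
  Connected = ∀ u v → ∃[ k ] Walk u v k

  -- A cycle: distinct vertices u, v₁ … vₘ, w (m ≥ 1, so ≥ 3 vertices),
  -- consecutive ones adjacent, and w adjacent to u.
  HasCycle : Set
  HasCycle = ∃[ u ] ∃[ w ] Σ (List (Fin n)) λ vs →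
               (1 ≤ length vs) × Linked Adj (u ∷ vs ++ [ w ])
               × Unique (u ∷ vs ++ [ w ]) × Adj w u

  IsTree : Set
  IsTree = Connected × ¬ HasCycle

  Dist : Fin n → Fin n → ℕ → Set
  Dist u v d = Walk u v d × (∀ k → Walk u v k → d ≤ k)

  Ecc : Fin n → ℕ → Set
  Ecc v e = (∀ u → ∃[ d ] (Dist v u d × d ≤ e)) × ∃[ u ] Dist v u e

  Central : Fin n → Set
  Central v = ∃[ e ] (Ecc v e × (∀ u e′ → Ecc u e′ → e ≤ e′))

  Unicentric : Set
  Unicentric = ∃[ c ] (Central c × (∀ v → Central v → v ≡ c))

  record Automorphism : Set where
    field
      to      : Fin n → Fin n
      from    : Fin n → Fin n
      to-from : ∀ v → to (from v) ≡ v
      from-to : ∀ v → from (to v) ≡ v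
      hom     : ∀ u v → adj G (to u) (to v) ≡ adj G u v

  IsIdentity : Automorphism → Set
  IsIdentity σ = ∀ v → Automorphism.to σ v ≡ v

  DistinguishingVertexLabeling : (r : ℕ) → (Fin n → Fin r) → Set
  DistinguishingVertexLabeling r f =
    ∀ (σ : Automorphism) → (∀ v → f (Automorphism.to σ v) ≡ f v) → IsIdentity σ

  -- an edge labeling with r labels: a label for each edge {u,v},
  -- represented by a function on ordered pairs that is symmetric on edges
  -- (its values on non-adjacent pairs are irrelevant)
  IsEdgeLabeling : (r : ℕ) → (Fin n → Fin n → Fin r) → Set
  IsEdgeLabeling r ℓ = ∀ u v → Adj u v → ℓ u v ≡ ℓ v u

  DistinguishingEdgeLabeling : (r : ℕ) → (Fin n → Fin n → Fin r) → Set
  DistinguishingEdgeLabeling r ℓ =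
    ∀ (σ : Automorphism) →
      (∀ u v → Adj u v → ℓ (Automorphism.to σ u) (Automorphism.to σ v) ≡ ℓ u v) →
      IsIdentity σ

  HasDistVertexLabeling : ℕ → Set
  HasDistVertexLabeling r = ∃[ f ] DistinguishingVertexLabeling r f

  HasDistEdgeLabeling : ℕ → Set
  HasDistEdgeLabeling r = ∃[ ℓ ] (IsEdgeLabeling r ℓ × DistinguishingEdgeLabeling r ℓ)

  DistinguishingNumber : ℕ → Set
  DistinguishingNumber r =
    HasDistVertexLabeling r × (∀ s → s < r → ¬ HasDistVertexLabeling s)

  DistinguishingIndex : ℕ → Set
  DistinguishingIndex r =
    HasDistEdgeLabeling r × (∀ s → s < r → ¬ HasDistEdgeLabeling s)

-- Every automorphism of a tree permutes its center, so an automorphism of a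
-- unicentric tree fixes the central vertex c and preserves the depth of every
-- vertex below c. In a tree the two ends of an edge lie at consecutive depths
-- and each vertex v ≠ c has a unique neighbour closer to c, its parent, which
-- automorphisms therefore respect. Hence labelling v ≠ c like the edge to its
-- parent, and an edge like its deeper end, turns distinguishing vertex labelings
-- into distinguishing edge labelings and back with the same number of labels;
-- the root's own label never matters since every automorphism fixes it.
module Submission where

open import Defs
open import Data.Bool using (if_then_else_)
open import Data.Bool.Properties using (if-float)
open import Data.Empty using (⊥-elim)
open import Data.Fin using (Fin)
open import Data.Fin.Properties using (_≟_)
open import Data.List using (List; []; _∷_; _++_; [_]; length)
open import Data.List.Properties using (length-++-≤ʳ)
open import Data.List.Relation.Unary.All as All using (All; []; _∷_)
open import Data.List.Relation.Unary.All.Properties using (++⁺)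
open import Data.List.Relation.Unary.AllPairs using ([]; _∷_)
open import Data.List.Relation.Unary.Linked using (Linked; [-]; _∷_)
open import Data.List.Relation.Unary.Unique.Propositional using (Unique)
open import Data.Nat using (ℕ; zero; suc; _≤_; _<_; _<?_; s≤s; z≤n)
open import Data.Nat.Properties
  using (≤-antisym; ≤-refl; ≤-reflexive; ≤-trans; ≤-pred; n≤1+n; <⇒≢; <-asym; <-cmp)
open import Data.Product using (Σ-syntax; ∃-syntax; _×_; _,_; proj₁; proj₂)
open import Data.Sum using (_⊎_; inj₁; inj₂)
open import Function.Base using (_∘_)
open import Function.Bundles using (_⇔_; mk⇔)
open import Relation.Binary using (tri<; tri≈; tri>)
open import Relation.Binary.PropositionalEquality
  using (_≡_; _≢_; ≢-sym; refl; sym; trans; cong; cong₂; subst; subst₂; module ≡-Reasoning)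
open import Relation.Nullary using (¬_; does; yes; no)
open import Relation.Nullary.Decidable using (dec-true; dec-false)

Linked-∷ʳ : ∀ {A : Set} {R : A → A → Set} {x y z : A} (xs : List A) →
            Linked R (x ∷ xs ++ [ y ]) → R y z → Linked R (x ∷ (xs ++ [ y ]) ++ [ z ])
Linked-∷ʳ []       (Rxy ∷ [-]) Ryz = Rxy ∷ Ryz ∷ [-]
Linked-∷ʳ (_ ∷ xs) (Rxw ∷ Rws) Ryz = Rxw ∷ Linked-∷ʳ xs Rws Ryz

Unique-∷ʳ : ∀ {A : Set} {xs : List A} {y : A} →
            Unique xs → All (_≢ y) xs → Unique (xs ++ [ y ])
Unique-∷ʳ []            []            = [] ∷ []
Unique-∷ʳ (x∉xs ∷ uxs) (x≢y ∷ xs≢y) = ++⁺ x∉xs (x≢y ∷ []) ∷ Unique-∷ʳ uxs xs≢y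

module GraphFacts {n : ℕ} (G : Graph n) where

  Adj-sym : ∀ {u v} → Adj G u v → Adj G v u
  Adj-sym {u} {v} uv = trans (adj-sym G v u) uv

  Adj⇒≢ : ∀ {u v} → Adj G u v → u ≢ v
  Adj⇒≢ {u} uu refl with trans (sym uu) (irrefl G u)
  ... | ()

  walk-∷ʳ : ∀ {u v w k} → Walk G u v k → Adj G v w → Walk G u w (suc k)
  walk-∷ʳ nil        vw = cons vw nil
  walk-∷ʳ (cons e p) vw = cons e (walk-∷ʳ p vw)

  walk-unsnoc : ∀ {u w k} → Walk G u w (suc k) → Σ[ v ∈ Fin n ] Walk G u v k × Adj G v w
  walk-unsnoc {u} (cons e nil) = u , nil , e
  walk-unsnoc (cons e (cons e′ p)) with walk-unsnoc (cons e′ p)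
  ... | v , q , vw = v , cons e q , vw

  walk-0⇒≡ : ∀ {u v} → Walk G u v 0 → u ≡ v
  walk-0⇒≡ nil = refl

  walk-map : ∀ (f : Fin n → Fin n) → (∀ u v → adj G (f u) (f v) ≡ adj G u v) →
             ∀ {u v k} → Walk G u v k → Walk G (f u) (f v) k
  walk-map f hom nil        = nil
  walk-map f hom (cons e p) = cons (trans (hom _ _) e) (walk-map f hom p)

  module AutomorphismFacts (σ : Automorphism G) where
    open Automorphism σ

    from-hom : ∀ u v → adj G (from u) (from v) ≡ adj G u v
    from-hom u v = trans (sym (hom (from u) (from v))) (cong₂ (adj G) (to-from u) (to-from v))

    walk-to : ∀ {u v k} → Walk G u v k → Walk G (to u) (to v) k
    walk-to = walk-map to hom

    walk-from : ∀ {u v k} → Walk G u v k → Walk G (from u) (from v) k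
    walk-from = walk-map from from-hom

    Dist-to : ∀ {u v d} → Dist G u v d → Dist G (to u) (to v) d
    Dist-to {u} {v} (p , shortest) =
      walk-to p
      , λ k q → shortest k (subst₂ (λ x y → Walk G x y k) (from-to u) (from-to v) (walk-from q))

    Ecc-to : ∀ {v e} → Ecc G v e → Ecc G (to v) e
    Ecc-to {v} (bounded , (u , far)) =
      (λ w → let (d , vw , d≤e) = bounded (from w)
             in d , subst (λ x → Dist G (to v) x d) (to-from w) (Dist-to vw) , d≤e)
      , (to u , Dist-to far)

    Central-to : ∀ {v} → Central G v → Central G (to v)
    Central-to (e , ecc , minimal) = e , Ecc-to ecc , minimal

  unicentric-fixed : ∀ {c} → Central G c → (∀ v → Central G v → v ≡ c) →
                     ∀ (σ : Automorphism G) → Automorphism.to σ c ≡ c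
  unicentric-fixed central unique σ = unique _ (AutomorphismFacts.Central-to σ central)

  number⇔index : (∀ r → HasDistVertexLabeling G r → HasDistEdgeLabeling G r) →
                 (∀ r → HasDistEdgeLabeling G r → HasDistVertexLabeling G r) →
                 ∀ r → DistinguishingNumber G r ⇔ DistinguishingIndex G r
  number⇔index V→E E→V r =
    mk⇔ (λ (vl , fewer) → V→E r vl , λ s s<r el → fewer s s<r (E→V s el))
        (λ (el , fewer) → E→V r el , λ s s<r vl → fewer s s<r (V→E s vl))

module Rooted {n : ℕ} (G : Graph n) (c : Fin n) (distances : ∀ v → ∃[ d ] Dist G c v d) where
  open GraphFacts G

  depth : Fin n → ℕ
  depth v = proj₁ (distances v)

  depth-walk : ∀ v → Walk G c v (depth v)
  depth-walk v = proj₁ (proj₂ (distances v))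

  depth-minimal : ∀ v k → Walk G c v k → depth v ≤ k
  depth-minimal v = proj₂ (proj₂ (distances v))

  depth-0⇒root : ∀ {v} → depth v ≡ 0 → v ≡ c
  depth-0⇒root {v} d≡0 = sym (walk-0⇒≡ (subst (Walk G c v) d≡0 (depth-walk v)))

  depth-adj : ∀ {u v} → Adj G u v → depth v ≤ suc (depth u)
  depth-adj {u} {v} uv = depth-minimal v _ (walk-∷ʳ (depth-walk u) uv)

  depth-step⇒≢ : ∀ {u v k} → depth u ≤ k → depth v ≡ suc k → u ≢ v
  depth-step⇒≢ {u} du≤k dv u≡v = <⇒≢ (subst (depth u <_) (sym dv) (s≤s du≤k)) (cong depth u≡v)

  predecessor : ∀ v k → depth v ≡ suc k → Σ[ u ∈ Fin n ] Adj G u v × depth u ≡ k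
  predecessor v k dv≡1+k with walk-unsnoc (subst (Walk G c v) dv≡1+k (depth-walk v))
  ... | u , cu , uv =
    u , uv , ≤-antisym (depth-minimal u k cu)
                       (≤-pred (subst (_≤ suc (depth u)) dv≡1+k (depth-adj uv)))

  parentAt : ∀ v m → depth v ≡ m → Fin n
  parentAt v zero    _  = v
  parentAt v (suc k) dv = proj₁ (predecessor v k dv)

  -- The root is its own parent, a junk value.
  parent : Fin n → Fin n
  parent v = parentAt v (depth v) refl

  parentAt-spec : ∀ v m (dv : depth v ≡ m) {k} → m ≡ suc k →
                  Adj G (parentAt v m dv) v × depth (parentAt v m dv) ≡ k
  parentAt-spec v (suc k) dv refl = proj₂ (predecessor v k dv)

  parent-spec : ∀ {v k} → depth v ≡ suc k → Adj G (parent v) v × depth (parent v) ≡ k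
  parent-spec {v} = parentAt-spec v (depth v) refl

  ShallowPath : Fin n → List (Fin n) → Fin n → ℕ → Set
  ShallowPath x vs y k =
    Linked (Adj G) (x ∷ vs ++ [ y ]) × Unique (x ∷ vs ++ [ y ])
    × All (λ v → depth v ≤ k) (x ∷ vs ++ [ y ])

  shallow-≢ : ∀ {k y vs} → All (λ v → depth v ≤ k) vs → depth y ≡ suc k → All (_≢ y) vs
  shallow-≢ shallow dy = All.map (λ dv≤k → depth-step⇒≢ dv≤k dy) shallow

  ancestorPath : ℕ → Fin n → Fin n → List (Fin n)
  ancestorPath zero    x y = []
  ancestorPath (suc k) x y with parent x ≟ parent y
  ... | yes _ = [ parent x ]
  ... | no  _ = parent x ∷ ancestorPath k (parent x) (parent y) ++ [ parent y ]

  ancestorPath-nonempty : ∀ k x y → 1 ≤ length (ancestorPath (suc k) x y)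
  ancestorPath-nonempty k x y with parent x ≟ parent y
  ... | yes _ = s≤s z≤n
  ... | no  _ = s≤s z≤n

  ancestorPath-shallow : ∀ k x y → x ≢ y → depth x ≡ k → depth y ≡ k →
                         ShallowPath x (ancestorPath k x y) y k
  ancestorPath-shallow zero x y x≢y dx dy =
    ⊥-elim (x≢y (trans (depth-0⇒root dx) (sym (depth-0⇒root dy))))
  ancestorPath-shallow (suc k) x y x≢y dx dy
    with parent x ≟ parent y | parent-spec dx | parent-spec dy
  ... | yes px≡py | px-x , dpx | py-y , _ =
    Adj-sym px-x ∷ subst (λ z → Adj G z y) (sym px≡py) py-y ∷ [-]
    , (≢-sym (depth-step⇒≢ (≤-reflexive dpx) dx) ∷ x≢y ∷ [])
      ∷ (depth-step⇒≢ (≤-reflexive dpx) dy ∷ []) ∷ [] ∷ []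
    , ≤-reflexive dx ∷ ≤-trans (≤-reflexive dpx) (n≤1+n k) ∷ ≤-reflexive dy ∷ []
  ... | no px≢py | px-x , dpx | py-y , dpy
    with ancestorPath-shallow k (parent x) (parent y) px≢py dpx dpy
  ... | linked , unique , shallow =
    Adj-sym px-x ∷ Linked-∷ʳ (ancestorPath k (parent x) (parent y)) linked py-y
    , ++⁺ (All.map ≢-sym (shallow-≢ shallow dx)) (x≢y ∷ [])
      ∷ Unique-∷ʳ unique (shallow-≢ shallow dy)
    , ≤-reflexive dx ∷ ++⁺ (All.map (λ le → ≤-trans le (n≤1+n k)) shallow) (≤-reflexive dy ∷ [])

  -- Distinct vertices of equal depth are joined through their ancestors by a path of
  -- shallower vertices, so an edge between them, or a common deeper neighbour, closes a cycle.
  module Acyclic (acyclic : ¬ HasCycle G) where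

    no-level-edge : ∀ {u v} → Adj G u v → depth u ≢ depth v
    no-level-edge {u} {v} uv du≡dv with depth u in du
    ... | zero  = Adj⇒≢ uv (trans (depth-0⇒root du) (sym (depth-0⇒root (sym du≡dv))))
    ... | suc k with ancestorPath-shallow (suc k) u v (Adj⇒≢ uv) du (sym du≡dv)
    ... | linked , unique , _ =
      acyclic (u , v , ancestorPath (suc k) u v , ancestorPath-nonempty k u v
              , linked , unique , Adj-sym uv)

    parent-unique : ∀ {u v} → Adj G u v → depth v ≡ suc (depth u) → u ≡ parent v
    parent-unique {u} {v} uv dv with u ≟ parent v
    ... | yes u≡pv = u≡pv
    ... | no  u≢pv with parent-spec dv
    ... | pv-v , dpv with ancestorPath-shallow (depth u) u (parent v) u≢pv refl dpv
    ... | linked , unique , shallow =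
      ⊥-elim (acyclic (u , v , path ++ [ parent v ] , length-++-≤ʳ [ parent v ] {path}
                      , Linked-∷ʳ path linked pv-v
                      , Unique-∷ʳ unique (shallow-≢ shallow dv) , Adj-sym uv))
      where path = ancestorPath (depth u) u (parent v)

    edge-parent : ∀ {u v} → Adj G u v →
                  (depth v ≡ suc (depth u) × u ≡ parent v)
                  ⊎ (depth u ≡ suc (depth v) × v ≡ parent u)
    edge-parent {u} {v} uv with <-cmp (depth u) (depth v)
    ... | tri< du<dv _ _ = let dv = ≤-antisym (depth-adj uv) du<dv in inj₁ (dv , parent-unique uv dv)
    ... | tri≈ _ du≡dv _ = ⊥-elim (no-level-edge uv du≡dv)
    ... | tri> _ _ dv<du =
      let du = ≤-antisym (depth-adj (Adj-sym uv)) dv<du in inj₂ (du , parent-unique (Adj-sym uv) du)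

  deeper : Fin n → Fin n → Fin n
  deeper u v = if does (depth u <? depth v) then v else u

  deeper-< : ∀ {u v} → depth u < depth v → deeper u v ≡ v
  deeper-< {u} {v} du<dv rewrite dec-true (depth u <? depth v) du<dv = refl

  deeper-≮ : ∀ {u v} → ¬ depth u < depth v → deeper u v ≡ u
  deeper-≮ {u} {v} du≮dv rewrite dec-false (depth u <? depth v) du≮dv = refl

  deeper-comm : ∀ {u v} → depth u ≢ depth v → deeper u v ≡ deeper v u
  deeper-comm {u} {v} du≢dv with <-cmp (depth u) (depth v)
  ... | tri< du<dv _ _ = trans (deeper-< du<dv) (sym (deeper-≮ (<-asym du<dv)))
  ... | tri≈ _ du≡dv _ = ⊥-elim (du≢dv du≡dv)
  ... | tri> _ _ dv<du = trans (deeper-≮ (<-asym dv<du)) (sym (deeper-< dv<du))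

  module RootFixing (σ : Automorphism G) (σc : Automorphism.to σ c ≡ c) where
    open Automorphism σ
    open AutomorphismFacts σ

    depth-to : ∀ v → depth (to v) ≡ depth v
    depth-to v = ≤-antisym
      (depth-minimal (to v) _ (subst (λ x → Walk G x (to v) _) σc (walk-to (depth-walk v))))
      (depth-minimal v _
        (subst₂ (λ x y → Walk G x y _) σ⁻¹c (from-to v) (walk-from (depth-walk (to v)))))
      where σ⁻¹c = trans (sym (cong from σc)) (from-to c)

    parent-to : ¬ HasCycle G → ∀ {v k} → depth v ≡ suc k → parent (to v) ≡ to (parent v)
    parent-to acyclic {v} dv with parent-spec dv
    ... | pv-v , dpv =
      sym (Acyclic.parent-unique acyclic (trans (hom _ _) pv-v)
             (trans (depth-to v) (trans dv (cong suc (sym (trans (depth-to (parent v)) dpv))))))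

    deeper-to : ∀ u v → deeper (to u) (to v) ≡ to (deeper u v)
    deeper-to u v rewrite depth-to u | depth-to v = sym (if-float to (does (depth u <? depth v)))

  module Labelings (acyclic : ¬ HasCycle G)
                   (root-fixed : ∀ (σ : Automorphism G) → Automorphism.to σ c ≡ c) where
    open Acyclic acyclic
    open ≡-Reasoning

    vertex→edge : ∀ r → HasDistVertexLabeling G r → HasDistEdgeLabeling G r
    vertex→edge r (f , distinguishing) = ℓ , ℓ-sym , ℓ-distinguishing
      where
        ℓ : Fin n → Fin n → Fin r
        ℓ u v = f (deeper u v)

        ℓ-sym : IsEdgeLabeling G r ℓ
        ℓ-sym u v uv = cong f (deeper-comm (no-level-edge uv))

        ℓ-distinguishing : DistinguishingEdgeLabeling G r ℓ
        ℓ-distinguishing σ ℓ-preserved = distinguishing σ f-preserved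
          where
            open Automorphism σ
            open RootFixing σ (root-fixed σ)

            f-preserved : ∀ v → f (to v) ≡ f v
            f-preserved v with depth v in dv
            ... | zero  =
              cong f (trans (cong to (depth-0⇒root dv)) (trans (root-fixed σ) (sym (depth-0⇒root dv))))
            ... | suc k with parent-spec dv
            ... | pv-v , dpv = begin
              f (to v)                         ≡⟨ cong (f ∘ to) (sym (deeper-< pv<v)) ⟩
              f (to (deeper (parent v) v))     ≡⟨ cong f (sym (deeper-to (parent v) v)) ⟩
              ℓ (to (parent v)) (to v)         ≡⟨ ℓ-preserved (parent v) v pv-v ⟩
              ℓ (parent v) v                   ≡⟨ cong f (deeper-< pv<v) ⟩
              f v                              ∎
              where
                pv<v : depth (parent v) < depth v
                pv<v = subst₂ _<_ (sym dpv) (sym dv) ≤-refl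

    edge→vertex : ∀ r → HasDistEdgeLabeling G r → HasDistVertexLabeling G r
    edge→vertex r (ℓ , ℓ-sym , distinguishing) = f , f-distinguishing
      where
        f : Fin n → Fin r
        f v = ℓ v (parent v)

        f-distinguishing : DistinguishingVertexLabeling G r f
        f-distinguishing σ f-preserved = distinguishing σ ℓ-preserved
          where
            open Automorphism σ
            open RootFixing σ (root-fixed σ)

            upward-preserved : ∀ {v k} → depth v ≡ suc k →
                               ℓ (to v) (to (parent v)) ≡ ℓ v (parent v)
            upward-preserved {v} dv =
              trans (cong (ℓ (to v)) (sym (parent-to acyclic dv))) (f-preserved v)

            ℓ-preserved : ∀ u v → Adj G u v → ℓ (to u) (to v) ≡ ℓ u v
            ℓ-preserved u v uv with edge-parent uv
            ... | inj₁ (dv , refl) = begin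
              ℓ (to (parent v)) (to v)  ≡⟨ ℓ-sym _ _ (trans (hom _ _) uv) ⟩
              ℓ (to v) (to (parent v))  ≡⟨ upward-preserved dv ⟩
              ℓ v (parent v)            ≡⟨ ℓ-sym _ _ (Adj-sym uv) ⟩
              ℓ (parent v) v            ∎
            ... | inj₂ (du , refl) = upward-preserved du

lemma1 : (n : ℕ) (T : Graph n) → 3 ≤ n → IsTree T → Unicentric T →
    (r : ℕ) → DistinguishingNumber T r ⇔ DistinguishingIndex T r
lemma1 _ T _ (_ , acyclic) (c , central@(_ , (bounded , _) , _) , unique) =
  number⇔index vertex→edge edge→vertex
  where
    open GraphFacts T

    distances : ∀ v → ∃[ d ] Dist T c v d
    distances v = let (d , cv , _) = bounded v in d , cv

    open Rooted T c distances
    open Labelings acyclic (unicentric-fixed central unique)
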